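{- There exists a constant $c > 0$ such that for all sufficiently large $k$, $\Omega(3,k) > k^{c \log k}$.
   Context: $\Omega(3,k)$ is the smallest integer $n$ such that every set $\{x_1, \ldots, x_n\}$ of integers with $x_i \in [(i-1)k+1, ik]$ for each $i$ contains a $3$-term arithmetic progression (with positive common difference). -}

module Defs where

open import Data.Nat using (ℕ; suc; _+_; _*_; _^_; _≤_; _<_)
open import Data.Nat.Logarithm using (⌊log₂_⌋)
open import Data.Fin using (Fin; toℕ)
open import Data.Product using (Σ; ∃; _×_)
open import Relation.Nullary using (¬_)
open import Relation.Binary.PropositionalEquality using (_≡_)

-- An admissible sequence x_1..x_n (indexed by Fin n, i = 0..n-1):
-- x_i ∈ [i*k + 1, (i+1)*k]   (the paper's x_i ∈ [(i-1)k+1, ik], 1-based)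
Admissible : (k n : ℕ) → (Fin n → ℕ) → Set
Admissible k n x = ∀ (i : Fin n) → (toℕ i * k + 1 ≤ x i) × (x i ≤ suc (toℕ i) * k)

HasAP3 : (n : ℕ) → (Fin n → ℕ) → Set
HasAP3 n x = Σ (Fin n) λ i → Σ (Fin n) λ j → Σ (Fin n) λ l → Σ ℕ λ d →
  (0 < d) × (x j ≡ x i + d) × (x l ≡ x i + (d + d))

Forces3AP : (k n : ℕ) → Set
Forces3AP k n = ∀ (x : Fin n → ℕ) → Admissible k n x → HasAP3 n x

IsOmega3 : (k n : ℕ) → Set
IsOmega3 k n = Forces3AP k n × (∀ m → m < n → ¬ Forces3AP k m)

-- A map φ : [0, N) → [0, k/2) that sends no non-trivial 3-term progression a, b, c
-- (a + c = 2b, a ≠ c) to a progression gives the AP-free admissible sequence x_i = i k + φ(i) + 1,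
-- so Ω(3,k) > N. Such a φ is built à la Behrend: write t in base D = 2B, split each digit
-- as h B + l with h ∈ {0,1}, l < B, and put φ(t) = Σ l_j² + M Σ h_j 3^j. Bits add without
-- carry in base 3, so the high bits of a, b, c agree; then the low digits add without carry
-- in base D, and strict convexity of squares forces a = c. Taking B = 2^d and d ≈ log₂ k / 6
-- keeps φ below k / 2 while N = (2B)^d = 2^{d(d+1)}, i.e. log Ω(3,k) ≳ (log k)² / 36.

module Submission where

open import Defs
open import Data.Nat using (ℕ; _*_; _^_; _≤_; _<_)
open import Data.Nat.Logarithm using (⌊log₂_⌋)
open import Data.Product using (Σ; _×_)

open import Data.Fin using (Fin; toℕ; inject≤)
open import Data.Fin.Properties using (toℕ<n; toℕ-inject≤)
open import Data.Nat using (zero; suc; _+_; _/_; _%_; ⌊_/2⌋; ⌈_/2⌉; z≤n; s≤s; s≤s⁻¹; z<s; NonZero; >-nonZero)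
open import Data.Nat.DivMod using (m≡m%n+[m/n]*n; m%n<n; [m+kn]%n≡m%n; m<n⇒m%n≡m; m<n*o⇒m/o<n; m/n*n≤m; /-monoˡ-≤)
open import Data.Nat.Logarithm using (⌊log₂⌋-mono-≤; ⌊log₂[2^n]⌋≡n)
open import Data.Nat.Logarithm.Core using (⌊log2⌋)
open import Data.Nat.Properties
open import Algebra.Properties.CommutativeSemigroup +-commutativeSemigroup using (interchange)
open import Data.Nat.Tactic.RingSolver using (solve-∀)
open import Data.Product using (_,_; proj₁; proj₂)
import Data.Product as Product
open import Data.Sum using (_⊎_; inj₁; inj₂)
open import Function using (_∘_)
open import Induction.WellFounded using (Acc; acc)
open import Relation.Nullary using (¬_; contradiction)
open import Relation.Binary.PropositionalEquality

record Midpoint (x y z : ℕ) : Set where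
  constructor midpoint
  field sum≡ : x + z ≡ y + y

quotRem-unique : ∀ {m r₁ q₁ r₂ q₂} → r₁ < m → r₂ < m →
  r₁ + q₁ * m ≡ r₂ + q₂ * m → r₁ ≡ r₂ × q₁ ≡ q₂
quotRem-unique {m} {r₁} {q₁} {r₂} {q₂} r₁<m r₂<m eq =
  r₁≡r₂ , *-cancelʳ-≡ q₁ q₂ m (+-cancelˡ-≡ r₁ _ _ (trans eq (cong (_+ q₂ * m) (sym r₁≡r₂))))
  where
  instance
    m≢0 : NonZero m
    m≢0 = >-nonZero (≤-<-trans z≤n r₁<m)
  remainder : ∀ {r} q → r < m → (r + q * m) % m ≡ r
  remainder {r} q r<m = trans ([m+kn]%n≡m%n r q m) (m<n⇒m%n≡m r<m)
  r₁≡r₂ : r₁ ≡ r₂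
  r₁≡r₂ = trans (sym (remainder q₁ r₁<m)) (trans (cong (_% m) eq) (remainder q₂ r₂<m))

digit+*< : ∀ {m n x q} → x < m → q < n → x + q * m < n * m
digit+*< {m} {n} {x} {q} x<m q<n = begin-strict
  x + q * m <⟨ +-monoˡ-< (q * m) x<m ⟩
  suc q * m ≤⟨ *-monoˡ-≤ m q<n ⟩
  n * m     ∎
  where open ≤-Reasoning

midpoint-digits : ∀ {m x y z x′ y′ z′} → x + z < m → y + y < m →
  Midpoint (x + x′ * m) (y + y′ * m) (z + z′ * m) → Midpoint x y z × Midpoint x′ y′ z′
midpoint-digits {m} {x} {y} {z} {x′} {y′} {z′} x+z<m y+y<m (midpoint mid) =
  Product.map midpoint midpoint
    (quotRem-unique x+z<m y+y<m (trans (sym (regroup m x x′ z z′)) (trans mid (regroup m y y′ y y′))))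
  where
  regroup : ∀ n a a′ c c′ → (a + a′ * n) + (c + c′ * n) ≡ (a + c) + (a′ + c′) * n
  regroup = solve-∀

midpoint-suc⁻¹ : ∀ {x y z} → Midpoint (suc x) (suc y) (suc z) → Midpoint x y z
midpoint-suc⁻¹ {x} {y} {z} (midpoint mid) = midpoint (suc-injective (begin
  suc (x + z) ≡⟨ sym (+-suc x z) ⟩
  x + suc z   ≡⟨ suc-injective mid ⟩
  y + suc y   ≡⟨ +-suc y y ⟩
  suc (y + y) ∎))
  where open ≡-Reasoning

m+m≡n+n⇒m≡n : ∀ {m n} → m + m ≡ n + n → m ≡ n
m+m≡n+n⇒m≡n {m} {n} eq = trans (n≡⌊n+n/2⌋ m) (trans (cong ⌊_/2⌋ eq) (sym (n≡⌊n+n/2⌋ n)))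

midpoint-bits : ∀ {u v w} → u ≤ 1 → v ≤ 1 → w ≤ 1 → Midpoint u v w → u ≡ v × w ≡ v
midpoint-bits z≤n       z≤n       z≤n       _  = refl , refl
midpoint-bits (s≤s z≤n) (s≤s z≤n) (s≤s z≤n) _  = refl , refl
midpoint-bits z≤n       z≤n       (s≤s z≤n) (midpoint ())
midpoint-bits z≤n       (s≤s z≤n) z≤n       (midpoint ())
midpoint-bits z≤n       (s≤s z≤n) (s≤s z≤n) (midpoint ())
midpoint-bits (s≤s z≤n) z≤n       z≤n       (midpoint ())
midpoint-bits (s≤s z≤n) z≤n       (s≤s z≤n) (midpoint ())
midpoint-bits (s≤s z≤n) (s≤s z≤n) z≤n       (midpoint ())

-- With z = x + g and x + z = 2y:  2(x² + z²) = (2y)² + g².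
midpoint-square-≤ : ∀ {x y z} → x ≤ z → Midpoint x y z → x ≡ z ⊎ y * y + y * y < x * x + z * z
midpoint-square-≤ {x} {y} x≤z (midpoint mid) with m≤n⇒∃[o]m+o≡n x≤z
... | zero  , refl = inj₁ (sym (+-identityʳ x))
... | suc g , refl = inj₂ (*-cancelˡ-< 2 _ _ (begin-strict
  2 * (y * y + y * y)                                   ≡⟨ double-square y ⟩
  (y + y) * (y + y)                                     ≡⟨ cong (λ s → s * s) (sym mid) ⟩
  (x + (x + suc g)) * (x + (x + suc g))                 <⟨ m<m+n _ z<s ⟩
  (x + (x + suc g)) * (x + (x + suc g)) + suc g * suc g ≡⟨ parallelogram x (suc g) ⟩
  2 * (x * x + (x + suc g) * (x + suc g))               ∎))
  where
  open ≤-Reasoning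
  double-square : ∀ y → 2 * (y * y + y * y) ≡ (y + y) * (y + y)
  double-square = solve-∀
  parallelogram : ∀ x g → (x + (x + g)) * (x + (x + g)) + g * g ≡ 2 * (x * x + (x + g) * (x + g))
  parallelogram = solve-∀

midpoint-square : ∀ {x y z} → Midpoint x y z → x ≡ z ⊎ y * y + y * y < x * x + z * z
midpoint-square {x} {y} {z} mid with ≤-total x z
... | inj₁ x≤z = midpoint-square-≤ x≤z mid
... | inj₂ z≤x with midpoint-square-≤ {y = y} z≤x (midpoint (trans (+-comm z x) (Midpoint.sum≡ mid)))
...   | inj₁ z≡x = inj₁ (sym z≡x)
...   | inj₂ lt  = inj₂ (subst (y * y + y * y <_) (+-comm (z * z) (x * x)) lt)

midpoint-weak : ∀ (f : ℕ → ℕ) {x y z} → Midpoint x y z →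
  x ≡ z ⊎ f y + f y < f x + f z → f y + f y ≤ f x + f z
midpoint-weak f mid (inj₁ refl) =
  ≤-reflexive (cong (λ t → f t + f t) (sym (m+m≡n+n⇒m≡n (Midpoint.sum≡ mid))))
midpoint-weak f mid (inj₂ lt)   = <⇒≤ lt

interchange-< : ∀ a b c d e h →
  (a + a) + (b + b) < (c + d) + (e + h) → (a + b) + (a + b) < (c + e) + (d + h)
interchange-< a b c d e h = subst₂ _<_ (interchange a a b b) (interchange c d e h)

midpoint-strict-+ : ∀ (f g : ℕ → ℕ) {x y z x′ y′ z′} → Midpoint x y z → Midpoint x′ y′ z′ →
  x ≡ z ⊎ f y + f y < f x + f z → x′ ≡ z′ ⊎ g y′ + g y′ < g x′ + g z′ →
  (x ≡ z × x′ ≡ z′) ⊎ (f y + g y′) + (f y + g y′) < (f x + g x′) + (f z + g z′)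
midpoint-strict-+ f g mid mid′ (inj₁ x≡z) (inj₁ x′≡z′) = inj₁ (x≡z , x′≡z′)
midpoint-strict-+ f g {x} {y} {z} {x′} {y′} {z′} mid mid′ (inj₂ lt) s′ =
  inj₂ (interchange-< (f y) (g y′) (f x) (f z) (g x′) (g z′) (+-mono-<-≤ lt (midpoint-weak g mid′ s′)))
midpoint-strict-+ f g {x} {y} {z} {x′} {y′} {z′} mid mid′ s (inj₂ lt′) =
  inj₂ (interchange-< (f y) (g y′) (f x) (f z) (g x′) (g z′) (+-mono-≤-< (midpoint-weak f mid s) lt′))

BreaksAPs : ℕ → (ℕ → ℕ) → Set
BreaksAPs n φ = ∀ {a b c} → a < n → c < n → Midpoint a b c → Midpoint (φ a) (φ b) (φ c) → a ≡ c

BreaksAPs⇒¬Forces3AP : ∀ {k n m} (φ : ℕ → ℕ) → BreaksAPs n φ →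
  (∀ t → t < n → φ t < m) → m + m ≤ k → ¬ Forces3AP k n
BreaksAPs⇒¬Forces3AP {k} {n} {m} φ breaks φ<m m+m≤k forces = no-AP (forces x admissible)
  where
  g : ℕ → ℕ
  g t = suc (φ t + t * k)
  x : Fin n → ℕ
  x = g ∘ toℕ
  φ<k : ∀ i → φ (toℕ i) < k
  φ<k i = <-≤-trans (φ<m (toℕ i) (toℕ<n i)) (≤-trans (m≤m+n m m) m+m≤k)
  φ+φ<k : ∀ i l → φ (toℕ i) + φ (toℕ l) < k
  φ+φ<k i l = <-≤-trans (+-mono-< (φ<m _ (toℕ<n i)) (φ<m _ (toℕ<n l))) m+m≤k
  admissible : Admissible k n x
  admissible i = subst (_≤ x i) (+-comm 1 (toℕ i * k)) (s≤s (m≤n+m _ (φ (toℕ i))))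
               , +-monoˡ-≤ (toℕ i * k) (φ<k i)
  spread : ∀ u e → u + (u + (e + e)) ≡ (u + e) + (u + e)
  spread = solve-∀
  no-AP : ¬ HasAP3 n x
  no-AP (i , j , l , e , 0<e , xj≡ , xl≡) =
    <-irrefl (trans (cong g a≡c) xl≡) (m<m+n (x i) (<-≤-trans 0<e (m≤m+n e e)))
    where
    a b c : ℕ
    a = toℕ i
    b = toℕ j
    c = toℕ l
    mid : Midpoint (x i) (x j) (x l)
    mid = midpoint (trans (cong (x i +_) xl≡) (trans (spread (x i) e) (sym (cong₂ _+_ xj≡ xj≡))))
    split : Midpoint (φ a) (φ b) (φ c) × Midpoint a b c
    split = midpoint-digits (φ+φ<k i l) (φ+φ<k j j) (midpoint-suc⁻¹ mid)
    a≡c : a ≡ c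
    a≡c = breaks (toℕ<n i) (toℕ<n l) (proj₂ split) (proj₁ split)

Forces3AP-mono : ∀ {k n m} → n ≤ m → Forces3AP k n → Forces3AP k m
Forces3AP-mono {k} {n} {m} n≤m forces x admissible = lift (forces (x ∘ inject) restricted)
  where
  inject : Fin n → Fin m
  inject i = inject≤ i n≤m
  restricted : Admissible k n (x ∘ inject)
  restricted i rewrite sym (toℕ-inject≤ i n≤m) = admissible (inject i)
  lift : HasAP3 n (x ∘ inject) → HasAP3 m x
  lift (i , j , l , ap) = inject i , inject j , inject l , ap

IsOmega3⇒> : ∀ {k n m} → IsOmega3 k n → ¬ Forces3AP k m → m < n
IsOmega3⇒> (forces , _) ¬forces = ≰⇒> (¬forces ∘ λ n≤m → Forces3AP-mono n≤m forces)

module Behrend (B : ℕ) .{{_ : NonZero B}} where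

  D : ℕ
  D = B + B

  lo hi rest low : ℕ → ℕ
  lo t = t % B
  hi t = t / B % 2
  rest t = t / B / 2
  low t = lo t + rest t * D

  digits : ∀ t → t ≡ hi t * B + low t
  digits t = begin
    t                              ≡⟨ m≡m%n+[m/n]*n t B ⟩
    lo t + t / B * B               ≡⟨ cong (λ u → lo t + u * B) (m≡m%n+[m/n]*n (t / B) 2) ⟩
    lo t + (hi t + rest t * 2) * B ≡⟨ regroup (hi t) (lo t) (rest t) B ⟩
    hi t * B + low t               ∎
    where
    open ≡-Reasoning
    regroup : ∀ h l r n → l + (h + r * 2) * n ≡ h * n + (l + r * (n + n))
    regroup = solve-∀

  digits-≡ : ∀ {a c} → hi a ≡ hi c → lo a ≡ lo c → rest a ≡ rest c → a ≡ c
  digits-≡ {a} {c} hi≡ lo≡ rest≡ =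
    trans (digits a) (trans (cong₂ _+_ (cong (_* B) hi≡) (cong₂ _+_ lo≡ (cong (_* D) rest≡))) (sym (digits c)))

  lo<B : ∀ t → lo t < B
  lo<B t = m%n<n t B

  hi≤1 : ∀ t → hi t ≤ 1
  hi≤1 t = s≤s⁻¹ (m%n<n (t / B) 2)

  rest< : ∀ {d t} → t < D ^ suc d → rest t < D ^ d
  rest< {d} {t} t< = m<n*o⇒m/o<n (m<n*o⇒m/o<n (subst (t <_) (reorder B (D ^ d)) t<))
    where
    reorder : ∀ n p → (n + n) * p ≡ p * 2 * n
    reorder = solve-∀

  midpoint-low : ∀ {a b c} → hi a ≡ hi b → hi c ≡ hi b → Midpoint a b c → Midpoint (low a) (low b) (low c)
  midpoint-low {a} {b} {c} hi-a hi-c (midpoint mid) = midpoint (+-cancelˡ-≡ (h * B + h * B) _ _ (begin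
    (h * B + h * B) + (low a + low c) ≡⟨ interchange (h * B) (h * B) (low a) (low c) ⟩
    (h * B + low a) + (h * B + low c) ≡⟨ sym (cong₂ _+_ (split hi-a) (split hi-c)) ⟩
    a + c                             ≡⟨ mid ⟩
    b + b                             ≡⟨ cong₂ _+_ (digits b) (digits b) ⟩
    (h * B + low b) + (h * B + low b) ≡⟨ interchange (h * B) (low b) (h * B) (low b) ⟩
    (h * B + h * B) + (low b + low b) ∎))
    where
    open ≡-Reasoning
    h : ℕ
    h = hi b
    split : ∀ {t} → hi t ≡ h → t ≡ h * B + low t
    split {t} hi-t = trans (digits t) (cong (λ u → u * B + low t) hi-t)

  E S : ℕ → ℕ → ℕ
  E zero    t = 0
  E (suc d) t = hi t + E d (rest t) * 3
  S zero    t = 0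
  S (suc d) t = lo t * lo t + S d (rest t)

  E< : ∀ d t → E d t < 3 ^ d
  E< zero    t = s≤s z≤n
  E< (suc d) t = subst (E (suc d) t <_) (*-comm (3 ^ d) 3)
    (digit+*< (s≤s (≤-trans (hi≤1 t) (n≤1+n 1))) (E< d (rest t)))

  S≤ : ∀ d t → S d t ≤ d * (B * B)
  S≤ zero    t = z≤n
  S≤ (suc d) t = +-mono-≤ (*-mono-≤ (<⇒≤ (lo<B t)) (<⇒≤ (lo<B t))) (S≤ d (rest t))

  E-midpoint⇒S-convex : ∀ d {a b c} → a < D ^ d → c < D ^ d → Midpoint a b c →
    Midpoint (E d a) (E d b) (E d c) → a ≡ c ⊎ S d b + S d b < S d a + S d c
  E-midpoint⇒S-convex zero {zero}  {c = zero}  _        _        _   _ = inj₁ refl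
  E-midpoint⇒S-convex zero {suc _}             (s≤s ()) _        _   _
  E-midpoint⇒S-convex zero {zero}  {c = suc _} _        (s≤s ()) _   _
  E-midpoint⇒S-convex (suc d) {a} {b} {c} a< c< mid E-mid =
    reassemble (midpoint-strict-+ (λ l → l * l) (S d) lo-mid rest-mid (midpoint-square lo-mid)
      (E-midpoint⇒S-convex d (rest< {d} a<) (rest< {d} c<) rest-mid (proj₂ hi-split)))
    where
    hi+hi<3 : ∀ s t → hi s + hi t < 3
    hi+hi<3 s t = s≤s (+-mono-≤ (hi≤1 s) (hi≤1 t))
    hi-split : Midpoint (hi a) (hi b) (hi c) × Midpoint (E d (rest a)) (E d (rest b)) (E d (rest c))
    hi-split = midpoint-digits (hi+hi<3 a c) (hi+hi<3 b b) E-mid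
    hi≡ : hi a ≡ hi b × hi c ≡ hi b
    hi≡ = midpoint-bits (hi≤1 a) (hi≤1 b) (hi≤1 c) (proj₁ hi-split)
    lo+lo<D : ∀ s t → lo s + lo t < D
    lo+lo<D s t = +-mono-< (lo<B s) (lo<B t)
    low-split : Midpoint (lo a) (lo b) (lo c) × Midpoint (rest a) (rest b) (rest c)
    low-split = midpoint-digits (lo+lo<D a c) (lo+lo<D b b)
      (midpoint-low (proj₁ hi≡) (proj₂ hi≡) mid)
    lo-mid : Midpoint (lo a) (lo b) (lo c)
    lo-mid = proj₁ low-split
    rest-mid : Midpoint (rest a) (rest b) (rest c)
    rest-mid = proj₂ low-split
    reassemble : (lo a ≡ lo c × rest a ≡ rest c) ⊎ S (suc d) b + S (suc d) b < S (suc d) a + S (suc d) c →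
      a ≡ c ⊎ S (suc d) b + S (suc d) b < S (suc d) a + S (suc d) c
    reassemble (inj₁ (lo≡ , rest≡)) = inj₁ (digits-≡ (trans (proj₁ hi≡) (sym (proj₂ hi≡))) lo≡ rest≡)
    reassemble (inj₂ lt)             = inj₂ lt

  encode : ℕ → ℕ → ℕ → ℕ
  encode d M t = S d t + E d t * M

  module _ (d M : ℕ) (S+S<M : d * (B * B) + d * (B * B) < M) where

    S<M : ∀ t → S d t < M
    S<M t = ≤-<-trans (≤-trans (S≤ d t) (m≤m+n _ _)) S+S<M

    encode< : ∀ t → encode d M t < 3 ^ d * M
    encode< t = digit+*< (S<M t) (E< d t)

    encode-breaksAPs : BreaksAPs (D ^ d) (encode d M)
    encode-breaksAPs {a} {b} {c} a< c< mid enc-mid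
      with midpoint-digits {M} {S d a} {S d b} {S d c} {E d a} {E d b} {E d c}
             (≤-<-trans (+-mono-≤ (S≤ d a) (S≤ d c)) S+S<M)
             (≤-<-trans (+-mono-≤ (S≤ d b) (S≤ d b)) S+S<M) enc-mid
    ... | S-mid , E-mid with E-midpoint⇒S-convex d a< c< mid E-mid
    ...   | inj₁ a≡c      = a≡c
    ...   | inj₂ S-strict = contradiction S-strict (<-irrefl (sym (Midpoint.sum≡ S-mid)))

  ¬Forces3AP-D^d : ∀ d k → d < B → 4 * (3 ^ d * (B * B * B)) ≤ k → ¬ Forces3AP k (D ^ d)
  ¬Forces3AP-D^d d k d<B k≥ =
    BreaksAPs⇒¬Forces3AP {m = 3 ^ d * M} (encode d M) (encode-breaksAPs d M bound)
      (λ t _ → encode< d M bound t)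
      (≤-trans (≤-reflexive (double (3 ^ d) (B * B * B))) k≥)
    where
    M : ℕ
    M = 2 * (B * B * B)
    instance
      B*B≢0 : NonZero (B * B)
      B*B≢0 = m*n≢0 B B
    cube : ∀ n → n * (n * n) + n * (n * n) ≡ 2 * (n * n * n)
    cube = solve-∀
    double : ∀ p q → p * (2 * q) + p * (2 * q) ≡ 4 * (p * q)
    double = solve-∀
    bound : d * (B * B) + d * (B * B) < M
    bound = subst (d * (B * B) + d * (B * B) <_) (cube B)
      (+-mono-< (*-monoˡ-< (B * B) d<B) (*-monoˡ-< (B * B) d<B))

n<2^n : ∀ n → n < 2 ^ n
n<2^n zero    = s≤s z≤n
n<2^n (suc n) = ≤-<-trans (n<2^n n) (m<m+n (2 ^ n) (≤-trans (m^n>0 2 n) (m≤m+n (2 ^ n) 0)))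

2^n≤m⇒n≤⌊log₂m⌋ : ∀ {m n} → 2 ^ n ≤ m → n ≤ ⌊log₂ m ⌋
2^n≤m⇒n≤⌊log₂m⌋ {m} {n} 2^n≤m = subst (_≤ ⌊log₂ m ⌋) (⌊log₂[2^n]⌋≡n n) (⌊log₂⌋-mono-≤ 2^n≤m)

n<2^[1+⌊log₂n⌋] : ∀ n → n < 2 ^ suc ⌊log₂ n ⌋
n<2^[1+⌊log₂n⌋] n = ≰⇒> (1+n≰n ∘ 2^n≤m⇒n≤⌊log₂m⌋)

2^⌊log2⌋≤ : ∀ n (rs : Acc _<_ (suc n)) → 2 ^ ⌊log2⌋ (suc n) rs ≤ suc n
2^⌊log2⌋≤ zero    _        = ≤-refl
2^⌊log2⌋≤ (suc n) (acc rs) = begin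
  2 * 2 ^ ⌊log2⌋ (suc h) _ ≤⟨ *-monoʳ-≤ 2 (2^⌊log2⌋≤ h _) ⟩
  2 * suc h                ≡⟨ cong suc (+-suc h (h + 0)) ⟩
  suc (suc (h + (h + 0)))  ≤⟨ s≤s (s≤s (+-monoʳ-≤ h h+0≤⌈n/2⌉)) ⟩
  suc (suc (h + ⌈ n /2⌉))  ≡⟨ cong (suc ∘ suc) (⌊n/2⌋+⌈n/2⌉≡n n) ⟩
  suc (suc n)              ∎
  where
  open ≤-Reasoning
  h : ℕ
  h = ⌊ n /2⌋
  h+0≤⌈n/2⌉ : h + 0 ≤ ⌈ n /2⌉
  h+0≤⌈n/2⌉ = ≤-trans (≤-reflexive (+-identityʳ h)) (⌊n/2⌋≤⌈n/2⌉ n)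

2^⌊log₂n⌋≤n : ∀ {n} → 1 ≤ n → 2 ^ ⌊log₂ n ⌋ ≤ n
2^⌊log₂n⌋≤n {suc n} _ = 2^⌊log2⌋≤ n _

Ω-lower-bound : ∀ {d k n} → 2 ≤ d → 2 ^ (d * 6) ≤ k → IsOmega3 k n → 2 ^ (suc d * d) < n
Ω-lower-bound {d} {k} {n} 2≤d 2^6d≤k ω =
  subst (_< n) D^d≡ (IsOmega3⇒> ω (¬Forces3AP-D^d d k (n<2^n d) k-large))
  where
  B : ℕ
  B = 2 ^ d
  instance
    B≢0 : NonZero B
    B≢0 = m^n≢0 2 d
  open Behrend B
  D^d≡ : D ^ d ≡ 2 ^ (suc d * d)
  D^d≡ = trans (cong (λ e → (B + e) ^ d) (sym (+-identityʳ B))) (^-*-assoc 2 (suc d) d)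
  3^d≤B*B : 3 ^ d ≤ B * B
  3^d≤B*B = begin
    3 ^ d       ≤⟨ ^-monoˡ-≤ d (n≤1+n 3) ⟩
    (2 ^ 2) ^ d ≡⟨ ^-*-assoc 2 2 d ⟩
    2 ^ (2 * d) ≡⟨ cong (λ e → 2 ^ (d + e)) (+-identityʳ d) ⟩
    2 ^ (d + d) ≡⟨ ^-distribˡ-+-* 2 d d ⟩
    B * B       ∎
    where open ≤-Reasoning
  sixth-power : ∀ b → b * (b * b * (b * b * b)) ≡ b * (b * (b * (b * (b * (b * 1)))))
  sixth-power = solve-∀
  k-large : 4 * (3 ^ d * (B * B * B)) ≤ k
  k-large = begin
    4 * (3 ^ d * (B * B * B))   ≤⟨ *-mono-≤ (^-monoʳ-≤ 2 2≤d) (*-monoˡ-≤ (B * B * B) 3^d≤B*B) ⟩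
    B * (B * B * (B * B * B))   ≡⟨ sixth-power B ⟩
    B ^ 6                       ≡⟨ ^-*-assoc 2 d 6 ⟩
    2 ^ (d * 6)                 ≤⟨ 2^6d≤k ⟩
    k                           ∎
    where open ≤-Reasoning

exponent-bound : ∀ {L d} → 1 ≤ d → L < suc d * 6 → suc L * L ≤ suc d * d * 72
exponent-bound {L} {d} 1≤d L< = begin
  suc L * L                     ≤⟨ *-mono-≤ L< (<⇒≤ L<) ⟩
  suc d * 6 * (suc d * 6)       ≤⟨ *-monoʳ-≤ (suc d * 6) (*-monoˡ-≤ 6 (+-monoˡ-≤ d 1≤d)) ⟩
  suc d * 6 * ((d + d) * 6)     ≡⟨ regroup d ⟩
  suc d * d * 72                ∎
  where
  open ≤-Reasoning
  regroup : ∀ d → suc d * 6 * ((d + d) * 6) ≡ suc d * d * 72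
  regroup = solve-∀

power-chain : ∀ {k n L e q} .{{_ : NonZero L}} →
  k < 2 ^ suc L → 2 ^ e < n → suc L * L ≤ e * q → k ^ L < n ^ q
power-chain {k} {n} {L} {e} {q} k< 2^e<n exponents = begin-strict
  k ^ L           <⟨ ^-monoˡ-< L k< ⟩
  (2 ^ suc L) ^ L ≡⟨ ^-*-assoc 2 (suc L) L ⟩
  2 ^ (suc L * L) ≤⟨ ^-monoʳ-≤ 2 exponents ⟩
  2 ^ (e * q)     ≡⟨ sym (^-*-assoc 2 e q) ⟩
  (2 ^ e) ^ q     ≤⟨ ^-monoˡ-≤ q (<⇒≤ 2^e<n) ⟩
  n ^ q           ∎
  where open ≤-Reasoning

k^⌊log₂k⌋<Ω^72 : ∀ {k n} → 2 ^ 12 ≤ k → IsOmega3 k n → k ^ ⌊log₂ k ⌋ < n ^ 72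
k^⌊log₂k⌋<Ω^72 {k} {n} k≥ ω =
  power-chain {e = suc d * d} {q = 72} {{L≢0}} (n<2^[1+⌊log₂n⌋] k) (Ω-lower-bound 2≤d 2^6d≤k ω)
    (exponent-bound (≤-trans (s≤s z≤n) 2≤d) L<)
  where
  L d : ℕ
  L = ⌊log₂ k ⌋
  d = L / 6
  12≤L : 12 ≤ L
  12≤L = 2^n≤m⇒n≤⌊log₂m⌋ k≥
  L≢0 : NonZero L
  L≢0 = >-nonZero (≤-trans (s≤s z≤n) 12≤L)
  2≤d : 2 ≤ d
  2≤d = /-monoˡ-≤ 6 12≤L
  L< : L < suc d * 6
  L< = begin-strict
    L             ≡⟨ m≡m%n+[m/n]*n L 6 ⟩
    L % 6 + d * 6 <⟨ +-monoˡ-< (d * 6) (m%n<n L 6) ⟩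
    6 + d * 6     ∎
    where open ≤-Reasoning
  2^6d≤k : 2 ^ (d * 6) ≤ k
  2^6d≤k = ≤-trans (^-monoʳ-≤ 2 (m/n*n≤m L 6)) (2^⌊log₂n⌋≤n (≤-trans (m^n>0 2 12) k≥))

corollary12 : Σ ℕ λ p → Σ ℕ λ q → (1 ≤ p) × (1 ≤ q) × (Σ ℕ λ K →
    ∀ k → K ≤ k → ∀ n → IsOmega3 k n → k ^ (p * ⌊log₂ k ⌋) < n ^ q)
corollary12 = 1 , 72 , s≤s z≤n , s≤s z≤n , 2 ^ 12 , λ k k≥ n ω →
  subst (λ e → k ^ e < n ^ 72) (sym (*-identityˡ ⌊log₂ k ⌋)) (k^⌊log₂k⌋<Ω^72 k≥ ω)
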